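{- Let $X=(G/\Gamma,G_\bullet)$ be a coset nilspace, let $N$ be a positive integer, and let $\phi:\mathbb{Z}_N\to G/\Gamma$ be a nilspace morphism, where $\mathbb{Z}_N$ carries its standard degree-1 cube structure. Then for every homomorphism $\beta:\mathbb{Z}\to\mathbb{Z}_N$ there is a polynomial map $g\in\mathrm{poly}(\mathbb{Z},G_\bullet)$ such that $\phi\circ\beta=\pi_\Gamma\circ g$.
   Context: $G$ is a group with a filtration $G_\bullet$: $G=G_0=G_1\supseteq G_2\supseteq\cdots\supseteq G_{k+1}=\{1\}$ for some $k$, with $[G_i,G_j]\subseteq G_{i+j}$; $\Gamma\le G$; $\pi_\Gamma:G\to G/\Gamma$ the quotient map. $C^n(G_\bullet)$ is the subgroup of $G^{\{0,1\}^n}$ generated by the maps $g^F$ with $F$ a face of $\{0,1\}^n$, $g\in G_{\mathrm{codim}F}$ ($g^F=g$ on $F$, $1$ elsewhere); the coset nilspace has $n$-cubes $\{\pi_\Gamma\circ c: c\in C^n(G_\bullet)\}$. The standard cubes of $\mathbb{Z}_N$ are the maps $v\mapsto x+v_1h_1+\cdots+v_nh_n$. A morphism maps cubes to cubes. $\mathrm{poly}(\mathbb{Z},G_\bullet)$ is the set of $g:\mathbb{Z}\to G$ with $\partial_{h_1}\cdots\partial_{h_i}g(n)\in G_i$ for all $i,n,h_j$, where $\partial_hg(n)=g(n+h)g(n)^{ -1}$. -}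

module Defs where

open import Level using (Level; _⊔_; suc)
open import Algebra.Bundles using (Group)
open import Data.Nat as ℕ using (ℕ; NonZero)
open import Data.Nat.DivMod using (_%_; m%n<n)
open import Data.Fin using (Fin; toℕ; fromℕ<)
open import Data.Integer as ℤ using (ℤ)
open import Data.Bool using (Bool; true; false)
open import Data.Maybe using (Maybe; just; nothing)
open import Data.Vec using (Vec; []; _∷_)
open import Data.Unit using (⊤)
open import Data.Product using (_×_)
open import Relation.Binary.PropositionalEquality using (_≡_)

module _ (N : ℕ) .{{_ : NonZero N}} where

  _+N_ : Fin N → Fin N → Fin N
  a +N b = fromℕ< (m%n<n (toℕ a ℕ.+ toℕ b) N)

  IsHomℤ : (ℤ → Fin N) → Set
  IsHomℤ β = ∀ m n → β (m ℤ.+ n) ≡ (β m +N β n)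

  stdCube : ∀ {n} → Fin N → Vec (Fin N) n → Vec Bool n → Fin N
  stdCube x []       []          = x
  stdCube x (h ∷ hs) (false ∷ v) = stdCube x hs v
  stdCube x (h ∷ hs) (true  ∷ v) = stdCube x hs v +N h

-- Faces of the discrete cube {0,1}ⁿ : a face fixes some coordinates
-- (just b) and leaves the others free (nothing).

Face : ℕ → Set
Face n = Vec (Maybe Bool) n

codim : ∀ {n} → Face n → ℕ
codim []             = 0
codim (nothing ∷ F)  = codim F
codim (just _ ∷ F)   = ℕ.suc (codim F)

inFace : ∀ {n} → Face n → Vec Bool n → Bool
inFace []             []          = true
inFace (nothing ∷ F)  (_ ∷ v)     = inFace F v
inFace (just true ∷ F)  (true ∷ v)  = inFace F v
inFace (just true ∷ F)  (false ∷ v) = false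
inFace (just false ∷ F) (false ∷ v) = inFace F v
inFace (just false ∷ F) (true ∷ v)  = false

module _ {c ℓ : Level} (G : Group c ℓ) where
  open Group G

  record IsSubgroup {p : Level} (H : Carrier → Set p) : Set (c ⊔ ℓ ⊔ p) where
    field
      resp  : ∀ {x y} → x ≈ y → H x → H y
      ε∈    : H ε
      ∙∈    : ∀ {x y} → H x → H y → H (x ∙ y)
      ⁻¹∈   : ∀ {x} → H x → H (x ⁻¹)

  [_,_] : Carrier → Carrier → Carrier
  [ x , y ] = x ⁻¹ ∙ y ⁻¹ ∙ x ∙ y

  record IsFiltration {p : Level} (k : ℕ) (Gᵢ : ℕ → Carrier → Set p)
         : Set (c ⊔ ℓ ⊔ p) where
    field
      subgroup : ∀ i → IsSubgroup (Gᵢ i)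
      G₀-full  : ∀ x → Gᵢ 0 x
      G₁-full  : ∀ x → Gᵢ 1 x
      decr     : ∀ i {x} → Gᵢ (ℕ.suc i) x → Gᵢ i x
      top      : ∀ {x} → Gᵢ (ℕ.suc k) x → x ≈ ε
      comm     : ∀ i j {x y} → Gᵢ i x → Gᵢ j y → Gᵢ (i ℕ.+ j) [ x , y ]

  module _ {p : Level} (Gᵢ : ℕ → Carrier → Set p) where

    faceMap : ∀ {n} → Face n → Carrier → Vec Bool n → Carrier
    faceMap F g v with inFace F v
    ... | true  = g
    ... | false = ε

    -- C^n(G_•): subgroup of G^{{0,1}ⁿ} generated by the g^F, g ∈ G_{codim F}
    -- (pointwise group operations; closed under pointwise ≈)
    data Cube (n : ℕ) : (Vec Bool n → Carrier) → Set (c ⊔ ℓ ⊔ p) where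
      gen  : ∀ (F : Face n) {g} → Gᵢ (codim F) g → Cube n (faceMap F g)
      one  : Cube n (λ _ → ε)
      mul  : ∀ {a b} → Cube n a → Cube n b → Cube n (λ v → a v ∙ b v)
      inv  : ∀ {a} → Cube n a → Cube n (λ v → a v ⁻¹)
      resp : ∀ {a b} → (∀ v → a v ≈ b v) → Cube n a → Cube n b

  module _ {q : Level} (Γ : Carrier → Set q) where

    _≈Γ_ : Carrier → Carrier → Set q
    x ≈Γ y = Γ (x ⁻¹ ∙ y)

    -- maps into G/Γ are represented by lifts into G; a map
    -- f : {0,1}ⁿ → G/Γ is a cube of the coset nilspace iff f = π_Γ ∘ c
    -- for some c ∈ Cⁿ(G_•)
    module _ {p : Level} (Gᵢ : ℕ → Carrier → Set p) where

      IsCosetCube : ∀ n → (Vec Bool n → Carrier) → Set (c ⊔ ℓ ⊔ p ⊔ q)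
      IsCosetCube n f = Data.Product.Σ (Vec Bool n → Carrier)
                          (λ cc → Cube Gᵢ n cc × (∀ v → f v ≈Γ cc v))

      IsMorphism : (N : ℕ) .{{_ : NonZero N}} → (Fin N → Carrier)
                   → Set (c ⊔ ℓ ⊔ p ⊔ q)
      IsMorphism N φ = ∀ n (x : Fin N) (hs : Vec (Fin N) n)
                       → IsCosetCube n (λ v → φ (stdCube N x hs v))

  ∂ : ℤ → (ℤ → Carrier) → ℤ → Carrier
  ∂ h g m = g (m ℤ.+ h) ∙ g m ⁻¹

  ∂s : ∀ {i} → Vec ℤ i → (ℤ → Carrier) → ℤ → Carrier
  ∂s []       g = g
  ∂s (h ∷ hs) g = ∂ h (∂s hs g)

  IsPoly : ∀ {p} → (ℕ → Carrier → Set p) → (ℤ → Carrier) → Set p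
  IsPoly Gᵢ g = ∀ i (hs : Vec ℤ i) (m : ℤ) → Gᵢ i (∂s hs g m)

-- Call P : ℤ → G cubical when its restriction to every standard cube of ℤ lies in Cⁿ(G_•).
-- Cubical maps are polynomial: the derivative of a cube along one coordinate is a cube for the
-- shifted filtration G_{•+1}, because conjugating a cube by a cube gives a cube (the commutators
-- it creates live on intersections of faces, one filtration step deeper).
--
-- The lift of φ ∘ β is built point by point.  Suppose a cubical g agrees with φ ∘ β modulo Γ at
-- 0, …, j.  On the cube of ℤ with base 0 and j + 1 steps equal to 1, the cubes of φ ∘ β and of g
-- agree modulo Γ at every vertex but the top one, and a cube lying in Γ off its top vertex has its
-- top vertex in G_{j+1}Γ.  So g (j + 1) is off by some t ∈ G_{j+1}, which multiplication by the
-- cubical map m ↦ t ^ (m choose j+1) removes without disturbing 0, …, j.  Once k + 1 consecutive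
-- values agree, the same argument yields a correction in G_{k+1} = {1}, so agreement propagates
-- to all of ℤ, upwards and (along steps of −1) downwards.

module Submission where

open import Defs
open import Level using (Level)
open import Algebra.Bundles using (Group)
open import Data.Nat using (ℕ; NonZero)
open import Data.Fin using (Fin)
open import Data.Integer using (ℤ)
open import Data.Product using (Σ; _×_)

open import Level using (_⊔_)
open import Algebra.Bundles using (CommutativeMonoid)
import Algebra.Properties.CommutativeSemigroup as CommutativeSemigroupProperties
import Algebra.Properties.Group as GroupProperties
import Algebra.Properties.Loop as LoopProperties
open import Data.Bool using (Bool; true; false; _∧_; if_then_else_)
import Data.Bool.Properties as Boolₚ
open import Data.Empty using (⊥-elim)
open import Data.Maybe using (just; nothing)
import Data.Nat as ℕ
open import Data.Nat using (zero; suc; _∸_; _≤_; _<_; z≤n; s≤s)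
import Data.Nat.Properties as ℕₚ
import Data.Integer as ℤ
open import Data.Integer using (+_; -[1+_])
import Data.Integer.Properties as ℤₚ
open import Data.Integer.Tactic.RingSolver using (solve-∀)
open import Data.Product using (_,_; proj₁; proj₂; map₂)
open import Data.Sum using (_⊎_; inj₁; inj₂)
open import Data.Vec as Vec using (Vec; []; _∷_; replicate)
open import Relation.Binary.PropositionalEquality as ≡ using (_≡_; _≗_; _≢_)
import Relation.Binary.Reasoning.Setoid as SetoidReasoning

stdCubeℤ : ℤ → ∀ {n} → Vec ℤ n → Vec Bool n → ℤ
stdCubeℤ x []       []          = x
stdCubeℤ x (h ∷ hs) (false ∷ v) = stdCubeℤ x hs v
stdCubeℤ x (h ∷ hs) (true  ∷ v) = stdCubeℤ x hs v ℤ.+ h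

stdCube-hom : ∀ N .{{_ : NonZero N}} {β : ℤ → Fin N} → IsHomℤ N β →
              ∀ x {n} (hs : Vec ℤ n) v → β (stdCubeℤ x hs v) ≡ stdCube N (β x) (Vec.map β hs) v
stdCube-hom N hom x []       []          = ≡.refl
stdCube-hom N hom x (h ∷ hs) (false ∷ v) = stdCube-hom N hom x hs v
stdCube-hom N {β} hom x (h ∷ hs) (true  ∷ v) =
  ≡.trans (hom (stdCubeℤ x hs v) h) (≡.cong (λ y → _+N_ N y (β h)) (stdCube-hom N hom x hs v))

morphism∘hom-cubical : ∀ {c ℓ p q} {G : Group c ℓ} {Gᵢ : ℕ → Group.Carrier G → Set p}
                       {Γ : Group.Carrier G → Set q} N .{{_ : NonZero N}} {φ : Fin N → Group.Carrier G}
                       {β : ℤ → Fin N} → IsMorphism G Γ Gᵢ N φ → IsHomℤ N β →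
                       ∀ n x (hs : Vec ℤ n) → IsCosetCube G Γ Gᵢ n (λ v → φ (β (stdCubeℤ x hs v)))
morphism∘hom-cubical {G = G} {Gᵢ} {Γ} N {φ} {β} φ-morphism β-hom n x hs =
  transport (φ-morphism n (β x) (Vec.map β hs))
  where
  transport : IsCosetCube G Γ Gᵢ n (λ v → φ (stdCube N (β x) (Vec.map β hs) v)) →
              IsCosetCube G Γ Gᵢ n (λ v → φ (β (stdCubeℤ x hs v)))
  transport (c , c-cube , φ∼c) =
    c , c-cube , λ v → ≡.subst (λ y → _≈Γ_ G Γ (φ y) (c v)) (≡.sym (stdCube-hom N β-hom x hs v)) (φ∼c v)

weight : ∀ {n} → Vec Bool n → ℕ
weight []          = 0
weight (true  ∷ v) = suc (weight v)
weight (false ∷ v) = weight v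

weight≤ : ∀ {n} (v : Vec Bool n) → weight v ≤ n
weight≤ []          = z≤n
weight≤ (true  ∷ v) = s≤s (weight≤ v)
weight≤ (false ∷ v) = ℕₚ.m≤n⇒m≤1+n (weight≤ v)

weight< : ∀ {n} (v : Vec Bool n) → v ≢ replicate n true → weight v < n
weight< []          v≢1 = ⊥-elim (v≢1 ≡.refl)
weight< (true  ∷ v) v≢1 = s≤s (weight< v (λ v≡1 → v≢1 (≡.cong (true ∷_) v≡1)))
weight< (false ∷ v) _   = s≤s (weight≤ v)

weight-replicate : ∀ n → weight (replicate n true) ≡ n
weight-replicate zero    = ≡.refl
weight-replicate (suc n) = ≡.cong suc (weight-replicate n)

-- Opaque, so that unification treats progression x e i as rigid and can infer x and e.
opaque
  progression : ℤ → ℤ → ℕ → ℤ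
  progression x e i = x ℤ.+ + i ℤ.* e

  stdCubeℤ-replicate : ∀ x e {n} (v : Vec Bool n) →
                       stdCubeℤ x (replicate n e) v ≡ progression x e (weight v)
  stdCubeℤ-replicate x e []          = base x e
    where base : ∀ x e → x ≡ x ℤ.+ + 0 ℤ.* e
          base = solve-∀
  stdCubeℤ-replicate x e (false ∷ v) = stdCubeℤ-replicate x e v
  stdCubeℤ-replicate x e (true  ∷ v) =
    ≡.trans (≡.cong (ℤ._+ e) (stdCubeℤ-replicate x e v)) (step x e (+ weight v))
    where step : ∀ x e i → (x ℤ.+ i ℤ.* e) ℤ.+ e ≡ x ℤ.+ (+ 1 ℤ.+ i) ℤ.* e
          step = solve-∀

  progression-step : ∀ x e i → progression (x ℤ.+ e) e i ≡ progression x e (suc i)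
  progression-step x e i = shift x e (+ i)
    where shift : ∀ x e i → (x ℤ.+ e) ℤ.+ i ℤ.* e ≡ x ℤ.+ (+ 1 ℤ.+ i) ℤ.* e
          shift = solve-∀

  progression-0-1 : ∀ i → progression (+ 0) (+ 1) i ≡ + i
  progression-0-1 i = unit (+ i)
    where unit : ∀ i → + 0 ℤ.+ i ℤ.* + 1 ≡ i
          unit = solve-∀

  progression-downward : ∀ {k i} → i ≤ k → progression (+ k) -[1+ 0 ] i ≡ + (k ∸ i)
  progression-downward {k} {i} i≤k = begin
    + k ℤ.+ + i ℤ.* -[1+ 0 ]
      ≡⟨ ≡.cong (λ n → + n ℤ.+ + i ℤ.* -[1+ 0 ]) (ℕₚ.m∸n+n≡m i≤k) ⟨
    + (k ∸ i ℕ.+ i) ℤ.+ + i ℤ.* -[1+ 0 ]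
      ≡⟨ ≡.cong (λ y → y ℤ.+ + i ℤ.* -[1+ 0 ]) (ℤₚ.pos-+ (k ∸ i) i) ⟩
    (+ (k ∸ i) ℤ.+ + i) ℤ.+ + i ℤ.* -[1+ 0 ]
      ≡⟨ cancel (+ (k ∸ i)) (+ i) ⟩
    + (k ∸ i) ∎
    where open ≡.≡-Reasoning
          cancel : ∀ a b → (a ℤ.+ b) ℤ.+ b ℤ.* -[1+ 0 ] ≡ a
          cancel = solve-∀

  progression-downward-past : ∀ n k → progression (+ k) -[1+ 0 ] (suc n ℕ.+ k) ≡ -[1+ n ]
  progression-downward-past n k =
    ≡.trans (≡.cong (λ y → + k ℤ.+ y ℤ.* -[1+ 0 ]) (ℤₚ.pos-+ (suc n) k)) (cancel (+ suc n) (+ k))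
    where cancel : ∀ a b → b ℤ.+ (a ℤ.+ b) ℤ.* -[1+ 0 ] ≡ ℤ.- a
          cancel = solve-∀

module IntegerPolynomial where
  open import Data.Integer using (_+_; _-_; -_)

  Δ : ℤ → (ℤ → ℤ) → ℤ → ℤ
  Δ h f m = f (m + h) - f m

  Degree≤ : ℕ → (ℤ → ℤ) → Set
  Degree≤ zero    f = ∀ a b → f a ≡ f b
  Degree≤ (suc d) f = ∀ h → Degree≤ d (Δ h f)

  Degree≤-resp : ∀ d {f g} → f ≗ g → Degree≤ d f → Degree≤ d g
  Degree≤-resp zero    f≗g deg a b = ≡.trans (≡.sym (f≗g a)) (≡.trans (deg a b) (f≗g b))
  Degree≤-resp (suc d) f≗g deg h =
    Degree≤-resp d (λ m → ≡.cong₂ _-_ (f≗g (m + h)) (f≗g m)) (deg h)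

  Degree≤-const : ∀ d a → Degree≤ d (λ _ → a)
  Degree≤-const zero    a _ _ = ≡.refl
  Degree≤-const (suc d) a h = Degree≤-resp d (λ _ → ≡.sym (ℤₚ.+-inverseʳ a)) (Degree≤-const d (+ 0))

  Degree≤-+ : ∀ d {f g} → Degree≤ d f → Degree≤ d g → Degree≤ d (λ m → f m + g m)
  Degree≤-+ zero    df dg a b = ≡.cong₂ _+_ (df a b) (dg a b)
  Degree≤-+ (suc d) {f} {g} df dg h =
    Degree≤-resp d (λ m → interchange (f (m + h)) (g (m + h)) (f m) (g m)) (Degree≤-+ d (df h) (dg h))
    where interchange : ∀ a b c d → (a - c) + (b - d) ≡ (a + b) - (c + d)
          interchange = solve-∀

  Degree≤-neg : ∀ d {f} → Degree≤ d f → Degree≤ d (λ m → - f m)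
  Degree≤-neg zero    df a b = ≡.cong -_ (df a b)
  Degree≤-neg (suc d) {f} df h =
    Degree≤-resp d (λ m → neg-diff (f (m + h)) (f m)) (Degree≤-neg d (df h))
    where neg-diff : ∀ a c → - (a - c) ≡ (- a) - (- c)
          neg-diff = solve-∀

  Degree≤-shift : ∀ d c {f} → Degree≤ d f → Degree≤ d (λ m → f (m + c))
  Degree≤-shift zero    c df a b = df (a + c) (b + c)
  Degree≤-shift (suc d) c {f} df h =
    Degree≤-resp d (λ m → ≡.cong (λ y → f y - f (m + c)) (swap m h c)) (Degree≤-shift d c (df h))
    where swap : ∀ m h c → (m + c) + h ≡ (m + h) + c
          swap = solve-∀

  Δ-+ : ∀ a b f m → Δ (a + b) f m ≡ Δ a f (m + b) + Δ b f m
  Δ-+ a b f m = ≡.trans (≡.cong (λ y → f y - f m) (reassoc m a b)) (telescope (f ((m + b) + a)) (f (m + b)) (f m))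
    where reassoc : ∀ m a b → m + (a + b) ≡ (m + b) + a
          reassoc = solve-∀
          telescope : ∀ x y z → x - z ≡ (x - y) + (y - z)
          telescope = solve-∀

  -- Δ₁ determines every Δₕ: split h into steps of ±1 via Δ-+.
  Δ₁-Degree≤ : ∀ d f → Degree≤ d (Δ (+ 1) f) → Degree≤ (suc d) f
  Δ₁-Degree≤ d f deg = λ where
      (+ n)    → forward n
      -[1+ n ] → backward n
    where
    forward : ∀ n → Degree≤ d (Δ (+ n) f)
    forward zero    = Degree≤-resp d Δ₀≡0 (Degree≤-const d (+ 0))
      where Δ₀≡0 : ∀ m → + 0 ≡ Δ (+ 0) f m
            Δ₀≡0 m = ≡.trans (≡.sym (ℤₚ.+-inverseʳ (f m)))
                             (≡.cong (λ y → f y - f m) (≡.sym (ℤₚ.+-identityʳ m)))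
    forward (suc n) = Degree≤-resp d (λ m → ≡.sym (Δ-+ (+ 1) (+ n) f m))
                        (Degree≤-+ d (Degree≤-shift d (+ n) deg) (forward n))
    backward : ∀ n → Degree≤ d (Δ -[1+ n ] f)
    backward zero    = Degree≤-resp d neg-Δ₁ (Degree≤-neg d (Degree≤-shift d -[1+ 0 ] deg))
      where neg-Δ₁ : ∀ m → - Δ (+ 1) f (m + -[1+ 0 ]) ≡ Δ -[1+ 0 ] f m
            neg-Δ₁ m = ≡.trans (≡.cong (λ y → - (f y - f (m + -[1+ 0 ]))) (pred-suc m))
                                (neg-flip (f m) (f (m + -[1+ 0 ])))
              where pred-suc : ∀ m → (m + -[1+ 0 ]) + + 1 ≡ m
                    pred-suc = solve-∀
                    neg-flip : ∀ a b → - (a - b) ≡ b - a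
                    neg-flip = solve-∀
    backward (suc n) = Degree≤-resp d (λ m → ≡.sym (Δ-+ -[1+ 0 ] -[1+ n ] f m))
                         (Degree≤-+ d (Degree≤-shift d -[1+ n ] (backward zero)) (backward n))

  binomial : ℕ → ℤ → ℤ
  binomial zero    _             = + 1
  binomial (suc j) (+ zero)      = + 0
  binomial (suc j) (+ suc n)     = binomial (suc j) (+ n) + binomial j (+ n)
  binomial (suc j) -[1+ zero ]   = - binomial j -[1+ zero ]
  binomial (suc j) -[1+ suc n ]  = binomial (suc j) -[1+ n ] - binomial j -[1+ suc n ]

  binomial-pascal : ∀ j m → binomial (suc j) (+ 1 + m) ≡ binomial (suc j) m + binomial j m
  binomial-pascal j (+ n)          = ≡.refl
  binomial-pascal j -[1+ zero ]    = ≡.sym (ℤₚ.+-inverseˡ (binomial j -[1+ zero ]))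
  binomial-pascal j -[1+ suc n ]   = ≡.sym (sub-add _ _)
    where sub-add : ∀ a b → (a - b) + b ≡ a
          sub-add = solve-∀

  Δ₁-binomial : ∀ j m → Δ (+ 1) (binomial (suc j)) m ≡ binomial j m
  Δ₁-binomial j m = begin
    binomial (suc j) (m + + 1) - binomial (suc j) m
      ≡⟨ ≡.cong (λ y → binomial (suc j) y - binomial (suc j) m) (ℤₚ.+-comm m (+ 1)) ⟩
    binomial (suc j) (+ 1 + m) - binomial (suc j) m
      ≡⟨ ≡.cong (_- binomial (suc j) m) (binomial-pascal j m) ⟩
    (binomial (suc j) m + binomial j m) - binomial (suc j) m
      ≡⟨ add-sub (binomial (suc j) m) (binomial j m) ⟩
    binomial j m ∎
    where open ≡.≡-Reasoning
          add-sub : ∀ a b → (a + b) - a ≡ b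
          add-sub = solve-∀

  Degree≤-binomial : ∀ j → Degree≤ j (binomial j)
  Degree≤-binomial zero    _ _ = ≡.refl
  Degree≤-binomial (suc j) =
    Δ₁-Degree≤ j (binomial (suc j)) (Degree≤-resp j (λ m → ≡.sym (Δ₁-binomial j m)) (Degree≤-binomial j))

  binomial-below : ∀ j i → i < j → binomial j (+ i) ≡ + 0
  binomial-below (suc j) zero    _         = ≡.refl
  binomial-below (suc j) (suc i) (s≤s i<j) =
    ≡.cong₂ _+_ (binomial-below (suc j) i (ℕₚ.m<n⇒m<1+n i<j)) (binomial-below j i i<j)

  binomial-diagonal : ∀ j → binomial j (+ j) ≡ + 1
  binomial-diagonal zero    = ≡.refl
  binomial-diagonal (suc j) = ≡.cong₂ _+_ (binomial-below (suc j) j (ℕₚ.n<1+n j)) (binomial-diagonal j)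

module FaceIntersection where
  open import Data.Nat using (_+_)
  open CommutativeSemigroupProperties (CommutativeMonoid.commutativeSemigroup Boolₚ.∧-commutativeMonoid)
    using () renaming (interchange to ∧-interchange)
  open CommutativeSemigroupProperties ℕₚ.+-commutativeSemigroup
    using () renaming (interchange to +-interchange)

  inFace-∷ : ∀ {n} x (F : Face n) b w → inFace (x ∷ F) (b ∷ w) ≡ (inFace (x ∷ []) (b ∷ []) ∧ inFace F w)
  inFace-∷ nothing      F b     w = ≡.refl
  inFace-∷ (just true)  F true  w = ≡.refl
  inFace-∷ (just true)  F false w = ≡.refl
  inFace-∷ (just false) F true  w = ≡.refl
  inFace-∷ (just false) F false w = ≡.refl

  codim-∷ : ∀ {n} x (F : Face n) → codim (x ∷ F) ≡ codim (x ∷ []) + codim F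
  codim-∷ nothing  F = ≡.refl
  codim-∷ (just _) F = ≡.refl

  data Meet {n} (F F′ : Face n) : Set where
    disjoint : (∀ v → (inFace F v ∧ inFace F′ v) ≡ false) → Meet F F′
    face     : ∀ M → (∀ v → (inFace F v ∧ inFace F′ v) ≡ inFace M v) →
               codim M ≤ codim F + codim F′ → Meet F F′

  meet₁ : ∀ x y → Meet (x ∷ []) (y ∷ [])
  meet₁ nothing      y            = face (y ∷ []) (λ { (_ ∷ []) → ≡.refl }) ℕₚ.≤-refl
  meet₁ (just b)     nothing      = face (just b ∷ []) (λ { (_ ∷ []) → Boolₚ.∧-identityʳ _ }) (s≤s z≤n)
  meet₁ (just true)  (just true)  = face (just true ∷ []) (λ v → Boolₚ.∧-idem _) (s≤s z≤n)
  meet₁ (just false) (just false) = face (just false ∷ []) (λ v → Boolₚ.∧-idem _) (s≤s z≤n)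
  meet₁ (just true)  (just false) = disjoint λ { (true ∷ []) → ≡.refl ; (false ∷ []) → ≡.refl }
  meet₁ (just false) (just true)  = disjoint λ { (true ∷ []) → ≡.refl ; (false ∷ []) → ≡.refl }

  ∧-inFace-∷ : ∀ {n} x y (F F′ : Face n) b w →
               (inFace (x ∷ F) (b ∷ w) ∧ inFace (y ∷ F′) (b ∷ w))
               ≡ ((inFace (x ∷ []) (b ∷ []) ∧ inFace (y ∷ []) (b ∷ [])) ∧ (inFace F w ∧ inFace F′ w))
  ∧-inFace-∷ x y F F′ b w =
    ≡.trans (≡.cong₂ _∧_ (inFace-∷ x F b w) (inFace-∷ y F′ b w))
            (∧-interchange (inFace (x ∷ []) (b ∷ [])) (inFace F w) (inFace (y ∷ []) (b ∷ [])) (inFace F′ w))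

  Meet-∷ : ∀ {n x y} {F F′ : Face n} → Meet (x ∷ []) (y ∷ []) → Meet F F′ → Meet (x ∷ F) (y ∷ F′)
  Meet-∷ {x = x} {y} {F} {F′} (disjoint d₁) _ = disjoint λ where
    (b ∷ w) → ≡.trans (∧-inFace-∷ x y F F′ b w) (≡.cong₂ _∧_ (d₁ (b ∷ [])) ≡.refl)
  Meet-∷ {x = x} {y} {F} {F′} (face _ _ _) (disjoint d) = disjoint λ where
    (b ∷ w) → ≡.trans (∧-inFace-∷ x y F F′ b w)
                (≡.trans (≡.cong ((inFace (x ∷ []) (b ∷ []) ∧ inFace (y ∷ []) (b ∷ [])) ∧_) (d w)) (Boolₚ.∧-zeroʳ _))
  Meet-∷ {x = x} {y} {F} {F′} (face (m ∷ []) e₁ le₁) (face M e le) = face (m ∷ M) e′ le′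
    where
    e′ : ∀ v → (inFace (x ∷ F) v ∧ inFace (y ∷ F′) v) ≡ inFace (m ∷ M) v
    e′ (b ∷ w) = ≡.trans (∧-inFace-∷ x y F F′ b w)
                   (≡.trans (≡.cong₂ _∧_ (e₁ (b ∷ [])) (e w)) (≡.sym (inFace-∷ m M b w)))
    le′ : codim (m ∷ M) ≤ codim (x ∷ F) + codim (y ∷ F′)
    le′ = begin
      codim (m ∷ M)
        ≡⟨ codim-∷ m M ⟩
      codim (m ∷ []) + codim M
        ≤⟨ ℕₚ.+-mono-≤ le₁ le ⟩
      (codim (x ∷ []) + codim (y ∷ [])) + (codim F + codim F′)
        ≡⟨ +-interchange (codim (x ∷ [])) (codim (y ∷ [])) (codim F) (codim F′) ⟩
      (codim (x ∷ []) + codim F) + (codim (y ∷ []) + codim F′)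
        ≡⟨ ≡.cong₂ _+_ (codim-∷ x F) (codim-∷ y F′) ⟨
      codim (x ∷ F) + codim (y ∷ F′) ∎
      where open ℕₚ.≤-Reasoning

  meet : ∀ {n} (F F′ : Face n) → Meet F F′
  meet []      []        = face [] (λ { [] → ≡.refl }) z≤n
  meet (x ∷ F) (y ∷ F′) = Meet-∷ (meet₁ x y) (meet F F′)

module Conjugation {c ℓ} (G : Group c ℓ) where
  open Group G
  open GroupProperties G
  open SetoidReasoning setoid

  conj : Carrier → Carrier → Carrier
  conj y x = y ∙ x ∙ y ⁻¹

  conj-cong : ∀ {y x x′} → x ≈ x′ → conj y x ≈ conj y x′
  conj-cong x≈x′ = ∙-congʳ (∙-congˡ x≈x′)

  conj-congˡ : ∀ {y y′ x} → y ≈ y′ → conj y x ≈ conj y′ x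
  conj-congˡ y≈y′ = ∙-cong (∙-congʳ y≈y′) (⁻¹-cong y≈y′)

  conj-∙ : ∀ y a b → conj y (a ∙ b) ≈ conj y a ∙ conj y b
  conj-∙ y a b = begin
    y ∙ (a ∙ b) ∙ y ⁻¹                ≈⟨ ∙-congʳ (assoc y a b) ⟨
    y ∙ a ∙ b ∙ y ⁻¹                  ≈⟨ ∙-congʳ (∙-congʳ (//-rightDividesˡ y (y ∙ a))) ⟨
    y ∙ a ∙ y ⁻¹ ∙ y ∙ b ∙ y ⁻¹       ≈⟨ ∙-congʳ (assoc _ y b) ⟩
    y ∙ a ∙ y ⁻¹ ∙ (y ∙ b) ∙ y ⁻¹     ≈⟨ assoc _ _ _ ⟩
    y ∙ a ∙ y ⁻¹ ∙ (y ∙ b ∙ y ⁻¹)     ∎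

  conj-ε : ∀ y → conj y ε ≈ ε
  conj-ε y = trans (∙-congʳ (identityʳ y)) (inverseʳ y)

  conj-⁻¹ : ∀ y a → conj y (a ⁻¹) ≈ conj y a ⁻¹
  conj-⁻¹ y a = inverseʳ-unique (conj y a) (conj y (a ⁻¹)) (begin
    conj y a ∙ conj y (a ⁻¹)  ≈⟨ conj-∙ y a (a ⁻¹) ⟨
    conj y (a ∙ a ⁻¹)         ≈⟨ conj-cong (inverseʳ a) ⟩
    conj y ε                  ≈⟨ conj-ε y ⟩
    ε                         ∎)

  conj-by-ε : ∀ x → conj ε x ≈ x
  conj-by-ε x = trans (∙-cong (identityˡ x) ε⁻¹≈ε) (identityʳ x)

  conj-by-∙ : ∀ y₁ y₂ x → conj (y₁ ∙ y₂) x ≈ conj y₁ (conj y₂ x)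
  conj-by-∙ y₁ y₂ x = begin
    y₁ ∙ y₂ ∙ x ∙ (y₁ ∙ y₂) ⁻¹          ≈⟨ ∙-congˡ (⁻¹-anti-homo-∙ y₁ y₂) ⟩
    y₁ ∙ y₂ ∙ x ∙ (y₂ ⁻¹ ∙ y₁ ⁻¹)       ≈⟨ assoc _ _ _ ⟨
    y₁ ∙ y₂ ∙ x ∙ y₂ ⁻¹ ∙ y₁ ⁻¹         ≈⟨ ∙-congʳ (∙-congʳ (assoc y₁ y₂ x)) ⟩
    y₁ ∙ (y₂ ∙ x) ∙ y₂ ⁻¹ ∙ y₁ ⁻¹       ≈⟨ ∙-congʳ (assoc y₁ _ _) ⟩
    y₁ ∙ (y₂ ∙ x ∙ y₂ ⁻¹) ∙ y₁ ⁻¹       ∎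

  conj≈∙commutator : ∀ h g → conj h g ≈ g ∙ [_,_] G g (h ⁻¹)
  conj≈∙commutator h g = begin
    h ∙ g ∙ h ⁻¹                          ≈⟨ ∙-congʳ (∙-congʳ (⁻¹-involutive h)) ⟨
    h ⁻¹ ⁻¹ ∙ g ∙ h ⁻¹                    ≈⟨ ∙-congʳ (∙-congʳ (\\-leftDividesˡ g _)) ⟨
    g ∙ (g ⁻¹ ∙ h ⁻¹ ⁻¹) ∙ g ∙ h ⁻¹       ≈⟨ ∙-congʳ (assoc _ _ _) ⟩
    g ∙ (g ⁻¹ ∙ h ⁻¹ ⁻¹ ∙ g) ∙ h ⁻¹       ≈⟨ assoc _ _ _ ⟩
    g ∙ (g ⁻¹ ∙ h ⁻¹ ⁻¹ ∙ g ∙ h ⁻¹)       ∎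

  //-∙ : ∀ a₁ a₀ b₁ b₀ → (a₁ ∙ b₁) // (a₀ ∙ b₀) ≈ conj a₁ (b₁ // b₀) ∙ (a₁ // a₀)
  //-∙ a₁ a₀ b₁ b₀ = begin
    a₁ ∙ b₁ ∙ (a₀ ∙ b₀) ⁻¹                  ≈⟨ ∙-congˡ (⁻¹-anti-homo-∙ a₀ b₀) ⟩
    a₁ ∙ b₁ ∙ (b₀ ⁻¹ ∙ a₀ ⁻¹)               ≈⟨ assoc _ _ _ ⟨
    a₁ ∙ b₁ ∙ b₀ ⁻¹ ∙ a₀ ⁻¹                 ≈⟨ ∙-congʳ (assoc _ _ _) ⟩
    a₁ ∙ (b₁ ∙ b₀ ⁻¹) ∙ a₀ ⁻¹               ≈⟨ ∙-congˡ (\\-leftDividesʳ a₁ _) ⟨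
    a₁ ∙ (b₁ // b₀) ∙ (a₁ ⁻¹ ∙ (a₁ ∙ a₀ ⁻¹)) ≈⟨ assoc _ _ _ ⟨
    conj a₁ (b₁ // b₀) ∙ (a₁ // a₀)         ∎

  //-⁻¹ : ∀ a₁ a₀ → a₁ ⁻¹ // a₀ ⁻¹ ≈ conj (a₁ ⁻¹) ((a₁ // a₀) ⁻¹)
  //-⁻¹ a₁ a₀ = begin
    a₁ ⁻¹ ∙ a₀ ⁻¹ ⁻¹                        ≈⟨ //-rightDividesʳ (a₁ ⁻¹) _ ⟨
    a₁ ⁻¹ ∙ a₀ ⁻¹ ⁻¹ ∙ a₁ ⁻¹ ∙ a₁ ⁻¹ ⁻¹      ≈⟨ ∙-congʳ (assoc _ _ _) ⟩
    a₁ ⁻¹ ∙ (a₀ ⁻¹ ⁻¹ ∙ a₁ ⁻¹) ∙ a₁ ⁻¹ ⁻¹    ≈⟨ ∙-congʳ (∙-congˡ (⁻¹-anti-homo-∙ a₁ (a₀ ⁻¹))) ⟨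
    conj (a₁ ⁻¹) ((a₁ // a₀) ⁻¹)            ∎

module IntegerPower {c ℓ} (G : Group c ℓ) where
  open Group G hiding (_-_)
  open import Data.Integer using (_+_; _-_; -_)
  open GroupProperties G
  open SetoidReasoning setoid

  infixr 8 _^_
  _^_ : Carrier → ℤ → Carrier
  t ^ + zero        = ε
  t ^ + suc n       = t ∙ t ^ + n
  t ^ -[1+ zero ]   = t ⁻¹
  t ^ -[1+ suc n ]  = t ⁻¹ ∙ t ^ -[1+ n ]

  ^-cong : ∀ t {a b} → a ≡ b → t ^ a ≈ t ^ b
  ^-cong t a≡b = reflexive (≡.cong (t ^_) a≡b)

  ^-suc : ∀ t m → t ^ (+ 1 + m) ≈ t ∙ t ^ m
  ^-suc t (+ n)          = refl
  ^-suc t -[1+ zero ]    = sym (inverseʳ t)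
  ^-suc t -[1+ suc n ]   = sym (\\-leftDividesˡ t _)

  ^-pred : ∀ t m → t ^ (-[1+ 0 ] + m) ≈ t ⁻¹ ∙ t ^ m
  ^-pred t (+ zero)  = sym (identityʳ _)
  ^-pred t (+ suc n) = sym (\\-leftDividesʳ t _)
  ^-pred t -[1+ n ]  = refl

  ^-+ : ∀ t a b → t ^ (a + b) ≈ t ^ a ∙ t ^ b
  ^-+ t (+ zero) b = trans (^-cong t (ℤₚ.+-identityˡ b)) (sym (identityˡ _))
  ^-+ t (+ suc n) b = begin
    t ^ (+ 1 + + n + b)     ≈⟨ ^-cong t (ℤₚ.+-assoc (+ 1) (+ n) b) ⟩
    t ^ (+ 1 + (+ n + b))   ≈⟨ ^-suc t (+ n + b) ⟩
    t ∙ t ^ (+ n + b)       ≈⟨ ∙-congˡ (^-+ t (+ n) b) ⟩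
    t ∙ (t ^ + n ∙ t ^ b)   ≈⟨ assoc _ _ _ ⟨
    t ∙ t ^ + n ∙ t ^ b     ∎
  ^-+ t -[1+ zero ] b = ^-pred t b
  ^-+ t -[1+ suc n ] b = begin
    t ^ (-[1+ 0 ] + -[1+ n ] + b)     ≈⟨ ^-cong t (ℤₚ.+-assoc -[1+ 0 ] -[1+ n ] b) ⟩
    t ^ (-[1+ 0 ] + (-[1+ n ] + b))   ≈⟨ ^-pred t (-[1+ n ] + b) ⟩
    t ⁻¹ ∙ t ^ (-[1+ n ] + b)         ≈⟨ ∙-congˡ (^-+ t -[1+ n ] b) ⟩
    t ⁻¹ ∙ (t ^ -[1+ n ] ∙ t ^ b)     ≈⟨ assoc _ _ _ ⟨
    t ⁻¹ ∙ t ^ -[1+ n ] ∙ t ^ b       ∎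

  ^-neg : ∀ t a → t ^ (- a) ≈ (t ^ a) ⁻¹
  ^-neg t a = inverseˡ-unique _ _ (begin
    t ^ (- a) ∙ t ^ a   ≈⟨ ^-+ t (- a) a ⟨
    t ^ (- a + a)       ≈⟨ ^-cong t (ℤₚ.+-inverseˡ a) ⟩
    ε                   ∎)

  ^-// : ∀ t a b → t ^ (a - b) ≈ t ^ a // t ^ b
  ^-// t a b = trans (^-+ t a (- b)) (∙-congˡ (^-neg t b))

  ^-∈ : ∀ {q} {H : Carrier → Set q} → IsSubgroup G H → ∀ {t} → H t → ∀ m → H (t ^ m)
  ^-∈ H-subgroup t∈ (+ zero)         = IsSubgroup.ε∈ H-subgroup
  ^-∈ H-subgroup t∈ (+ suc n)        = IsSubgroup.∙∈ H-subgroup t∈ (^-∈ H-subgroup t∈ (+ n))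
  ^-∈ H-subgroup t∈ -[1+ zero ]      = IsSubgroup.⁻¹∈ H-subgroup t∈
  ^-∈ H-subgroup t∈ -[1+ suc n ]     =
    IsSubgroup.∙∈ H-subgroup (IsSubgroup.⁻¹∈ H-subgroup t∈) (^-∈ H-subgroup t∈ -[1+ n ])

module FilteredGroup {c ℓ p} (G : Group c ℓ) (k : ℕ)
    (Gᵢ : ℕ → Group.Carrier G → Set p) (filtration : IsFiltration G k Gᵢ) where
  open Group G
  open import Data.Nat using (_+_)
  open IntegerPolynomial
  open FaceIntersection
  open GroupProperties G
  open LoopProperties loop using (x//ε≈x)
  open Conjugation G
  open IntegerPower G
  open IsFiltration filtration using (subgroup; decr)
  module Gᵢ-sub i = IsSubgroup (subgroup i)

  Gᵢ-cast : ∀ {i j x} → i ≡ j → Gᵢ i x → Gᵢ j x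
  Gᵢ-cast {x = x} = ≡.subst (λ i → Gᵢ i x)

  Gᵢ-mono : ∀ {i j x} → i ≤ j → Gᵢ j x → Gᵢ i x
  Gᵢ-mono {i} {j} {x} i≤j x∈ = lower (j ℕ.∸ i) (Gᵢ-cast (≡.sym (ℕₚ.m∸n+n≡m i≤j)) x∈)
    where lower : ∀ d → Gᵢ (d + i) x → Gᵢ i x
          lower zero    x∈ = x∈
          lower (suc d) x∈ = lower d (decr (d + i) x∈)

  Gᵢ-if : ∀ {i} b {g} → Gᵢ i g → Gᵢ i (if b then g else ε)
  Gᵢ-if true  g∈ = g∈
  Gᵢ-if {i} false _  = Gᵢ-sub.ε∈ i

  faceMap⁺ : ℕ → ∀ {n} → Face n → Carrier → Vec Bool n → Carrier
  faceMap⁺ s = faceMap G (λ i → Gᵢ (s + i))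

  faceMap≈if : ∀ s {n} (F : Face n) g v →
               faceMap⁺ s F g v ≈ (if inFace F v then g else ε)
  faceMap≈if s F g v with inFace F v
  ... | true  = refl
  ... | false = refl

  Cube⁺ : ℕ → (n : ℕ) → (Vec Bool n → Carrier) → Set (c ⊔ ℓ ⊔ p)
  Cube⁺ s = Cube G (λ i → Gᵢ (s + i))

  gen-if : ∀ {s n c} (F : Face n) {g} → Gᵢ (s + codim F) g →
           (∀ v → (if inFace F v then g else ε) ≈ c v) → Cube⁺ s n c
  gen-if {s} F {g} g∈ eq = resp (λ v → trans (faceMap≈if s F g v) (eq v)) (gen F g∈)

  Cube⁺-∈ : ∀ {s n c} → Cube⁺ s n c → ∀ v → Gᵢ s (c v)
  Cube⁺-∈ {s} (gen F {g} g∈) v =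
    Gᵢ-sub.resp s (sym (faceMap≈if s F g v)) (Gᵢ-if (inFace F v) (Gᵢ-mono (ℕₚ.m≤m+n s _) g∈))
  Cube⁺-∈ {s} one          v = Gᵢ-sub.ε∈ s
  Cube⁺-∈ {s} (mul a b)    v = Gᵢ-sub.∙∈ s (Cube⁺-∈ a v) (Cube⁺-∈ b v)
  Cube⁺-∈ {s} (inv a)      v = Gᵢ-sub.⁻¹∈ s (Cube⁺-∈ a v)
  Cube⁺-∈ {s} (resp eq a)  v = Gᵢ-sub.resp s (eq v) (Cube⁺-∈ a v)

  Gᵢ-lower : ∀ s {i g} → Gᵢ (s + suc i) g → Gᵢ (s + i) g
  Gᵢ-lower s {i} = Gᵢ-mono (ℕₚ.+-monoʳ-≤ s (ℕₚ.n≤1+n i))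

  Cube⁺-restrict : ∀ {s n c} b → Cube⁺ s (suc n) c → Cube⁺ s n (λ w → c (b ∷ w))
  Cube⁺-restrict {s} b (gen (nothing ∷ F) {g} g∈) =
    gen-if F g∈ (λ w → sym (faceMap≈if s (nothing ∷ F) g (b ∷ w)))
  Cube⁺-restrict {s} true (gen (just true ∷ F) {g} g∈) =
    gen-if F (Gᵢ-lower s g∈) (λ w → sym (faceMap≈if s (just true ∷ F) g (true ∷ w)))
  Cube⁺-restrict {s} false (gen (just false ∷ F) {g} g∈) =
    gen-if F (Gᵢ-lower s g∈) (λ w → sym (faceMap≈if s (just false ∷ F) g (false ∷ w)))
  Cube⁺-restrict {s} true (gen (just false ∷ F) {g} _) =
    resp (λ w → sym (faceMap≈if s (just false ∷ F) g (true ∷ w))) one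
  Cube⁺-restrict {s} false (gen (just true ∷ F) {g} _) =
    resp (λ w → sym (faceMap≈if s (just true ∷ F) g (false ∷ w))) one
  Cube⁺-restrict b one         = one
  Cube⁺-restrict b (mul a a′)  = mul (Cube⁺-restrict b a) (Cube⁺-restrict b a′)
  Cube⁺-restrict b (inv a)     = inv (Cube⁺-restrict b a)
  Cube⁺-restrict b (resp eq a) = resp (λ w → eq (b ∷ w)) (Cube⁺-restrict b a)

  Cube⁺-extend : ∀ {s n c} → Cube⁺ s n c → Cube⁺ s (suc n) (λ v → c (Vec.tail v))
  Cube⁺-extend {s} (gen F {g} g∈) = gen-if (nothing ∷ F) g∈ λ where
    (_ ∷ w) → sym (faceMap≈if s F g w)
  Cube⁺-extend one         = one
  Cube⁺-extend (mul a a′)  = mul (Cube⁺-extend a) (Cube⁺-extend a′)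
  Cube⁺-extend (inv a)     = inv (Cube⁺-extend a)
  Cube⁺-extend (resp eq a) = resp (λ v → eq (Vec.tail v)) (Cube⁺-extend a)

  Cube⁺-onUpperFace : ∀ {s n c} → Cube⁺ (suc s) n c →
                Cube⁺ s (suc n) (λ v → if Vec.head v then c (Vec.tail v) else ε)
  Cube⁺-onUpperFace {s} (gen F {g} g∈) =
    gen-if (just true ∷ F) (Gᵢ-cast (≡.sym (ℕₚ.+-suc s (codim F))) g∈) λ where
      (true  ∷ w) → sym (faceMap≈if (suc s) F g w)
      (false ∷ w) → refl
  Cube⁺-onUpperFace one = resp (λ { (true ∷ w) → refl ; (false ∷ w) → refl }) one
  Cube⁺-onUpperFace (mul a a′) =
    resp (λ { (true ∷ w) → refl ; (false ∷ w) → identityˡ ε }) (mul (Cube⁺-onUpperFace a) (Cube⁺-onUpperFace a′))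
  Cube⁺-onUpperFace (inv a) =
    resp (λ { (true ∷ w) → refl ; (false ∷ w) → ε⁻¹≈ε }) (inv (Cube⁺-onUpperFace a))
  Cube⁺-onUpperFace (resp eq a) =
    resp (λ { (true ∷ w) → eq w ; (false ∷ w) → refl }) (Cube⁺-onUpperFace a)

  conj-if : ∀ {g h} a b → (if a then g else ε) ∙ (if a ∧ b then [_,_] G g (h ⁻¹) else ε)
                          ≈ conj (if b then h else ε) (if a then g else ε)
  conj-if {g} {h} true true  = sym (conj≈∙commutator h g)
  conj-if {g} {h} true false = trans (identityʳ g) (sym (conj-by-ε g))
  conj-if false b            = trans (identityˡ ε) (sym (conj-ε _))

  Cube⁺-conj-face : ∀ {s r n} (F′ : Face n) {h} → Gᵢ (r + codim F′) h → ∀ {c} → Cube⁺ s n c →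
              Cube⁺ s n (λ v → conj (if inFace F′ v then h else ε) (c v))
  Cube⁺-conj-face {s} {r} F′ {h} h∈ (gen F {g} g∈) = resp conj-gen (mul (gen F g∈) commutators)
    where
    commutator∈ : Gᵢ ((s + codim F) + (r + codim F′)) ([_,_] G g (h ⁻¹))
    commutator∈ = IsFiltration.comm filtration _ _ g∈ (Gᵢ-sub.⁻¹∈ _ h∈)
    commutators : Cube⁺ s _ (λ v → if inFace F v ∧ inFace F′ v then [_,_] G g (h ⁻¹) else ε)
    commutators with meet F F′
    ... | disjoint d = resp (λ v → reflexive (≡.cong (λ b → if b then _ else ε) (≡.sym (d v)))) one
    ... | face M eq M≤ = gen-if M (Gᵢ-mono bound commutator∈)
                           (λ v → reflexive (≡.cong (λ b → if b then _ else ε) (≡.sym (eq v))))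
      where
      bound : s + codim M ≤ (s + codim F) + (r + codim F′)
      bound = begin
        s + codim M                     ≤⟨ ℕₚ.+-monoʳ-≤ s M≤ ⟩
        s + (codim F + codim F′)        ≡⟨ ℕₚ.+-assoc s _ _ ⟨
        (s + codim F) + codim F′        ≤⟨ ℕₚ.+-monoʳ-≤ (s + codim F) (ℕₚ.m≤n+m _ r) ⟩
        (s + codim F) + (r + codim F′)  ∎
        where open ℕₚ.≤-Reasoning
    conj-gen : ∀ v → faceMap⁺ s F g v ∙ (if inFace F v ∧ inFace F′ v then [_,_] G g (h ⁻¹) else ε)
                     ≈ conj (if inFace F′ v then h else ε) (faceMap⁺ s F g v)
    conj-gen v = trans (∙-congʳ (faceMap≈if s F g v))
                   (trans (conj-if (inFace F v) (inFace F′ v)) (conj-cong (sym (faceMap≈if s F g v))))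
  Cube⁺-conj-face F′ h∈ one         = resp (λ v → sym (conj-ε _)) one
  Cube⁺-conj-face F′ h∈ (mul a a′)  =
    resp (λ v → sym (conj-∙ _ _ _)) (mul (Cube⁺-conj-face F′ h∈ a) (Cube⁺-conj-face F′ h∈ a′))
  Cube⁺-conj-face F′ h∈ (inv a)     = resp (λ v → sym (conj-⁻¹ _ _)) (inv (Cube⁺-conj-face F′ h∈ a))
  Cube⁺-conj-face F′ h∈ (resp eq a) = resp (λ v → conj-cong (eq v)) (Cube⁺-conj-face F′ h∈ a)

  if-⁻¹ : ∀ b {h} → (if b then h ⁻¹ else ε) ≈ (if b then h else ε) ⁻¹
  if-⁻¹ true  = refl
  if-⁻¹ false = sym ε⁻¹≈ε

  -- Conjugation by y v ⁻¹ is carried along for the inv case of the induction.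
  Cube⁺-conj± : ∀ {r s n y c} → Cube⁺ r n y → Cube⁺ s n c →
                Cube⁺ s n (λ v → conj (y v) (c v)) × Cube⁺ s n (λ v → conj (y v ⁻¹) (c v))
  Cube⁺-conj± {r} (gen F′ {h} h∈) C =
    resp (λ v → conj-congˡ (sym (faceMap≈if r F′ h v))) (Cube⁺-conj-face F′ h∈ C) ,
    resp (λ v → conj-congˡ (trans (if-⁻¹ (inFace F′ v)) (⁻¹-cong (sym (faceMap≈if r F′ h v)))))
         (Cube⁺-conj-face F′ (Gᵢ-sub.⁻¹∈ _ h∈) C)
  Cube⁺-conj± one C =
    resp (λ v → sym (conj-by-ε _)) C ,
    resp (λ v → sym (trans (conj-congˡ ε⁻¹≈ε) (conj-by-ε _))) C
  Cube⁺-conj± (mul y₁ y₂) C =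
    resp (λ v → sym (conj-by-∙ _ _ _)) (proj₁ (Cube⁺-conj± y₁ (proj₁ (Cube⁺-conj± y₂ C)))) ,
    resp (λ v → sym (trans (conj-congˡ (⁻¹-anti-homo-∙ _ _)) (conj-by-∙ _ _ _)))
         (proj₂ (Cube⁺-conj± y₂ (proj₂ (Cube⁺-conj± y₁ C))))
  Cube⁺-conj± (inv y) C =
    proj₂ (Cube⁺-conj± y C) ,
    resp (λ v → conj-congˡ (sym (⁻¹-involutive _))) (proj₁ (Cube⁺-conj± y C))
  Cube⁺-conj± (resp eq y) C =
    resp (λ v → conj-congˡ (eq v)) (proj₁ (Cube⁺-conj± y C)) ,
    resp (λ v → conj-congˡ (⁻¹-cong (eq v))) (proj₂ (Cube⁺-conj± y C))

  Cube⁺-conj : ∀ {r s n y c} → Cube⁺ r n y → Cube⁺ s n c → Cube⁺ s n (λ v → conj (y v) (c v))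
  Cube⁺-conj y C = proj₁ (Cube⁺-conj± y C)

  faceMap-// : ∀ s {n} x (F : Face n) g w →
               faceMap⁺ s (x ∷ F) g (true ∷ w) // faceMap⁺ s (x ∷ F) g (false ∷ w)
               ≈ (if inFace (x ∷ F) (true ∷ w) then g else ε) // (if inFace (x ∷ F) (false ∷ w) then g else ε)
  faceMap-// s x F g w = //-cong₂ (faceMap≈if s (x ∷ F) g (true ∷ w)) (faceMap≈if s (x ∷ F) g (false ∷ w))

  Cube⁺-∂₁ : ∀ {s n c} → Cube⁺ s (suc n) c → Cube⁺ (suc s) n (λ w → c (true ∷ w) // c (false ∷ w))
  Cube⁺-∂₁ {s} (gen (nothing ∷ F) {g} _) =
    resp (λ w → sym (trans (faceMap-// s nothing F g w) (inverseʳ _))) one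
  Cube⁺-∂₁ {s} (gen (just true ∷ F) {g} g∈) =
    gen-if F (Gᵢ-cast (ℕₚ.+-suc s (codim F)) g∈) (λ w → sym (trans (faceMap-// s (just true) F g w) (x//ε≈x _)))
  Cube⁺-∂₁ {s} (gen (just false ∷ F) {g} g∈) =
    resp (λ w → sym (trans (faceMap-// s (just false) F g w)
                           (trans (identityˡ _) (⁻¹-cong (sym (faceMap≈if (suc s) F g w))))))
         (inv (gen F (Gᵢ-cast (ℕₚ.+-suc s (codim F)) g∈)))
  Cube⁺-∂₁ one         = resp (λ _ → sym (inverseʳ ε)) one
  Cube⁺-∂₁ (mul a b)   =
    resp (λ _ → sym (//-∙ _ _ _ _)) (mul (Cube⁺-conj (Cube⁺-restrict true a) (Cube⁺-∂₁ b)) (Cube⁺-∂₁ a))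
  Cube⁺-∂₁ (inv a)     =
    resp (λ _ → sym (//-⁻¹ _ _)) (Cube⁺-conj (inv (Cube⁺-restrict true a)) (inv (Cube⁺-∂₁ a)))
  Cube⁺-∂₁ (resp eq a) = resp (λ w → //-cong₂ (eq (true ∷ w)) (eq (false ∷ w))) (Cube⁺-∂₁ a)

  record Cubical (s : ℕ) (P : ℤ → Carrier) : Set (c ⊔ ℓ ⊔ p) where
    constructor cubical
    field cubeAt : ∀ n x (hs : Vec ℤ n) → Cube⁺ s n (λ v → P (stdCubeℤ x hs v))
  open Cubical

  Cubical-resp : ∀ {s P Q} → (∀ m → P m ≈ Q m) → Cubical s P → Cubical s Q
  Cubical-resp P≈Q P-cubical = cubical λ n x hs → resp (λ v → P≈Q (stdCubeℤ x hs v)) (cubeAt P-cubical n x hs)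

  Cubical-∙ : ∀ {s P Q} → Cubical s P → Cubical s Q → Cubical s (λ m → P m ∙ Q m)
  Cubical-∙ P-cubical Q-cubical = cubical λ n x hs → mul (cubeAt P-cubical n x hs) (cubeAt Q-cubical n x hs)

  Cubical-∂ : ∀ {s P} h → Cubical s P → Cubical (suc s) (∂ G h P)
  Cubical-∂ h P-cubical = cubical λ n x hs → Cube⁺-∂₁ (cubeAt P-cubical (suc n) x (h ∷ hs))

  Cubical-∂s : ∀ {P i} (hs : Vec ℤ i) → Cubical 0 P → Cubical i (∂s G hs P)
  Cubical-∂s []       P-cubical = P-cubical
  Cubical-∂s (h ∷ hs) P-cubical = Cubical-∂ h (Cubical-∂s hs P-cubical)

  Cubical⇒IsPoly : ∀ {P} → Cubical 0 P → IsPoly G Gᵢ P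
  Cubical⇒IsPoly P-cubical i hs m = Cube⁺-∈ (cubeAt (Cubical-∂s hs P-cubical) 0 m []) []

  -- The converse of Cubical-∂: moving a vertex along h multiplies its value by ∂_h P.
  Cubical-from-∂ : ∀ {s P} → (∀ m → Gᵢ s (P m)) → (∀ h → Cubical (suc s) (∂ G h P)) → Cubical s P
  Cubical-from-∂ {s} {P} P∈ ∂P-cubical = cubical cube
    where
    cube : ∀ n x (hs : Vec ℤ n) → Cube⁺ s n (λ v → P (stdCubeℤ x hs v))
    cube zero    x []       = gen-if [] (Gᵢ-cast (≡.sym (ℕₚ.+-identityʳ s)) (P∈ x)) (λ { [] → refl })
    cube (suc n) x (h ∷ hs) =
      resp step (mul (Cube⁺-onUpperFace (cubeAt (∂P-cubical h) n x hs)) (Cube⁺-extend (cube n x hs)))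
      where
      step : ∀ v → (if Vec.head v then ∂ G h P (stdCubeℤ x hs (Vec.tail v)) else ε) ∙ P (stdCubeℤ x hs (Vec.tail v))
                   ≈ P (stdCubeℤ x (h ∷ hs) v)
      step (true  ∷ w) = //-rightDividesˡ _ _
      step (false ∷ w) = identityˡ _

  Cubical-ε : ∀ {s} → Cubical s (λ _ → ε)
  Cubical-ε = cubical λ n x hs → one

  Cubical-const : ∀ {s a} → Gᵢ s a → Cubical s (λ _ → a)
  Cubical-const {a = a} a∈ = Cubical-from-∂ (λ _ → a∈) (λ h → Cubical-resp (λ _ → sym (inverseʳ a)) Cubical-ε)

  Cubical-^ : ∀ d s {t} → Gᵢ (d + s) t → ∀ f → Degree≤ d f → Cubical s (λ m → t ^ f m)
  Cubical-^ zero    s {t} t∈ f f-const =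
    Cubical-resp (λ m → ^-cong t (f-const (ℤ.+ 0) m)) (Cubical-const (^-∈ (subgroup s) t∈ (f (ℤ.+ 0))))
  Cubical-^ (suc d) s {t} t∈ f f-deg = Cubical-from-∂
    (λ m → ^-∈ (subgroup s) (Gᵢ-mono (ℕₚ.m≤n+m s (suc d)) t∈) (f m))
    (λ h → Cubical-resp (λ m → ^-// t (f (m ℤ.+ h)) (f m))
                        (Cubical-^ d (suc s) (Gᵢ-cast (≡.sym (ℕₚ.+-suc d s)) t∈) (Δ h f) (f-deg h)))

  module Modulo {q} {Γ : Carrier → Set q} (Γ-subgroup : IsSubgroup G Γ) where
    open IsSubgroup Γ-subgroup using () renaming (resp to Γ-resp; ε∈ to Γ-ε∈; ∙∈ to Γ-∙∈; ⁻¹∈ to Γ-⁻¹∈)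

    infix 4 _∼_
    _∼_ : Carrier → Carrier → Set q
    _∼_ = _≈Γ_ G Γ

    ∼-refl : ∀ {x} → x ∼ x
    ∼-refl {x} = Γ-resp (sym (inverseˡ x)) Γ-ε∈

    ∼-sym : ∀ {x y} → x ∼ y → y ∼ x
    ∼-sym x∼y = Γ-resp (⁻¹-anti-homo-\\ _ _) (Γ-⁻¹∈ x∼y)

    ∼-trans : ∀ {x y z} → x ∼ y → y ∼ z → x ∼ z
    ∼-trans {y = y} {z} x∼y y∼z = Γ-resp (trans (assoc _ _ _) (∙-congˡ (\\-leftDividesˡ y z))) (Γ-∙∈ x∼y y∼z)

    ∼-respʳ : ∀ {x y y′} → y ≈ y′ → x ∼ y → x ∼ y′
    ∼-respʳ y≈y′ = Γ-resp (∙-congˡ y≈y′)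

    top-vertex : ∀ {s n c} → Cube⁺ s n c → (∀ v → v ≢ replicate n true → Γ (c v)) →
                 Σ Carrier λ t → Gᵢ (s + n) t × t ∼ c (replicate n true)
    top-vertex {s} {zero} C _ = _ , Gᵢ-cast (≡.sym (ℕₚ.+-identityʳ s)) (Cube⁺-∈ C []) , ∼-refl
    top-vertex {s} {suc n} {c} C c∈Γ = lift (top-vertex (Cube⁺-∂₁ C) ∂c∈Γ)
      where
      top : Vec Bool n
      top = replicate n true
      ∂c∈Γ : ∀ w → w ≢ top → Γ (c (true ∷ w) // c (false ∷ w))
      ∂c∈Γ w w≢top =
        Γ-∙∈ (c∈Γ (true ∷ w) (λ eq → w≢top (≡.cong Vec.tail eq))) (Γ-⁻¹∈ (c∈Γ (false ∷ w) (λ ())))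
      lift : Σ Carrier (λ t → Gᵢ (suc s + n) t × t ∼ c (true ∷ top) // c (false ∷ top)) →
             Σ Carrier (λ t → Gᵢ (s + suc n) t × t ∼ c (true ∷ top))
      lift (t , t∈ , t∼) = t , Gᵢ-cast (≡.sym (ℕₚ.+-suc s n)) t∈ ,
        Γ-resp (trans (assoc _ _ _) (∙-congˡ (//-rightDividesˡ _ _))) (Γ-∙∈ t∼ (c∈Γ (false ∷ top) (λ ())))

    top-vertex-∼ : ∀ {s n a b} → Cube⁺ s n a → Cube⁺ s n b →
                   (∀ v → v ≢ replicate n true → a v ∼ b v) →
                   Σ Carrier λ t → Gᵢ (s + n) t × a (replicate n true) ∙ t ∼ b (replicate n true)
    top-vertex-∼ {n = n} {a} A B a∼b =
      map₂ (λ {t} → map₂ (Γ-resp (sym (trans (∙-congʳ (⁻¹-anti-homo-∙ (a (replicate n true)) t)) (assoc _ _ _)))))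
           (top-vertex (mul (inv A) B) a∼b)

    module Lifting (f : ℤ → Carrier)
        (f-cubical : ∀ n x (hs : Vec ℤ n) → IsCosetCube G Γ Gᵢ n (λ v → f (stdCubeℤ x hs v))) where

      AgreeOn : (ℤ → Carrier) → ℤ → ℤ → ℕ → Set q
      AgreeOn g x e L = ∀ i → i < L → f (progression x e i) ∼ g (progression x e i)

      Correction : (ℤ → Carrier) → ℤ → ℕ → Set (c ⊔ p ⊔ q)
      Correction g y j = Σ Carrier λ t → Gᵢ j t × f y ∼ g y ∙ t

      extension : ∀ {g} → Cubical 0 g → ∀ x e j → AgreeOn g x e j → Correction g (progression x e j) j
      extension {g} g-cubical x e j agree = complete (f-cubical j x (replicate j e))
        where
        y : Vec Bool j → ℤ
        y = stdCubeℤ x (replicate j e)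
        top : Vec Bool j
        top = replicate j true
        y-top : y top ≡ progression x e j
        y-top = ≡.trans (stdCubeℤ-replicate x e top) (≡.cong (progression x e) (weight-replicate j))
        complete : IsCosetCube G Γ Gᵢ j (λ v → f (y v)) → Correction g (progression x e j) j
        complete (c , c-cube , f∼c) = conclude (top-vertex-∼ (cubeAt g-cubical j x (replicate j e)) c-cube g∼c)
          where
          g∼c : ∀ v → v ≢ top → g (y v) ∼ c v
          g∼c v v≢top = ∼-trans (∼-sym (≡.subst (λ z → f z ∼ g z) (≡.sym (stdCubeℤ-replicate x e v))
                                                 (agree (weight v) (weight< v v≢top))))
                                (f∼c v)
          conclude : Σ Carrier (λ t → Gᵢ j t × g (y top) ∙ t ∼ c top) → Correction g (progression x e j) j
          conclude (t , t∈ , gt∼c) =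
            t , t∈ , ≡.subst (λ z → f z ∼ g z ∙ t) y-top (∼-trans (f∼c top) (∼-sym gt∼c))

      Correction-trivial : ∀ {g y} → Correction g y (suc k) → f y ∼ g y
      Correction-trivial (t , t∈ , ft) = ∼-respʳ (trans (∙-congˡ (IsFiltration.top filtration t∈)) (identityʳ _)) ft

      PartialLift : ℕ → Set (c ⊔ ℓ ⊔ p ⊔ q)
      PartialLift L = Σ (ℤ → Carrier) λ g → Cubical 0 g × AgreeOn g (+ 0) (+ 1) L

      refine : ∀ j → PartialLift (suc j) → PartialLift (suc (suc j))
      refine j (g , g-cubical , agree) = correct (extension g-cubical (+ 0) (+ 1) (suc j) agree)
        where
        correct : Correction g (progression (+ 0) (+ 1) (suc j)) (suc j) → PartialLift (suc (suc j))
        correct (t , t∈ , ft) = g′ , g′-cubical , agree′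
          where
          g′ : ℤ → Carrier
          g′ m = g m ∙ t ^ binomial (suc j) m
          g′-cubical : Cubical 0 g′
          g′-cubical = Cubical-∙ g-cubical
            (Cubical-^ (suc j) 0 (Gᵢ-cast (≡.sym (ℕₚ.+-identityʳ (suc j))) t∈)
                       (binomial (suc j)) (Degree≤-binomial (suc j)))
          t^binomial : ∀ i → t ^ binomial (suc j) (progression (+ 0) (+ 1) i) ≈ t ^ binomial (suc j) (+ i)
          t^binomial i = ^-cong t (≡.cong (binomial (suc j)) (progression-0-1 i))
          agree-at : ∀ {i} → i < suc j ⊎ i ≡ suc j → f (progression (+ 0) (+ 1) i) ∼ g′ (progression (+ 0) (+ 1) i)
          agree-at {i} (inj₁ i<suc-j) =
            ∼-respʳ (sym (trans (∙-congˡ (trans (t^binomial i) (^-cong t (binomial-below (suc j) i i<suc-j))))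
                               (identityʳ _)))
                    (agree i i<suc-j)
          agree-at {i} (inj₂ ≡.refl) =
            ∼-respʳ (∙-congˡ (sym (trans (t^binomial i) (trans (^-cong t (binomial-diagonal i)) (identityʳ t))))) ft
          agree′ : AgreeOn g′ (+ 0) (+ 1) (suc (suc j))
          agree′ i (s≤s i≤suc-j) = agree-at (ℕₚ.m≤n⇒m<n∨m≡n i≤suc-j)

      initial : ∀ j → PartialLift (suc j)
      initial zero    = (λ _ → f (+ 0)) , Cubical-const (IsFiltration.G₀-full filtration _) ,
                        λ { zero _ → ≡.subst (λ z → f z ∼ f (+ 0)) (≡.sym (progression-0-1 0)) ∼-refl
                          ; (suc i) (s≤s ()) }
      initial (suc j) = refine j (initial j)

      shift : ∀ {g} → Cubical 0 g → ∀ {x e} → AgreeOn g x e (suc k) → AgreeOn g (x ℤ.+ e) e (suc k)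
      shift {g} g-cubical {x} {e} agree i (s≤s i≤k) =
        ≡.subst (λ z → f z ∼ g z) (≡.sym (progression-step x e i)) (next (ℕₚ.m≤n⇒m<n∨m≡n i≤k))
        where
        next : i < k ⊎ i ≡ k → f (progression x e (suc i)) ∼ g (progression x e (suc i))
        next (inj₁ i<k)    = agree (suc i) (s≤s i<k)
        next (inj₂ ≡.refl) = Correction-trivial {g} (extension g-cubical x e (suc k) agree)

      agree-forward : ∀ {g} → Cubical 0 g → ∀ {x e} → AgreeOn g x e (suc k) →
                      ∀ i → f (progression x e i) ∼ g (progression x e i)
      agree-forward g-cubical agree zero    = agree zero (s≤s z≤n)
      agree-forward {g} g-cubical {x} {e} agree (suc i) =
        ≡.subst (λ z → f z ∼ g z) (progression-step x e i) (agree-forward g-cubical (shift g-cubical agree) i)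

      agree-everywhere : ∀ {g} → Cubical 0 g → AgreeOn g (+ 0) (+ 1) (suc k) → ∀ m → f m ∼ g m
      agree-everywhere {g} g-cubical agree = λ where
          (+ n)    → nonnegative n
          -[1+ n ] → ≡.subst (λ z → f z ∼ g z) (progression-downward-past n k)
                             (agree-forward g-cubical downward (suc n ℕ.+ k))
        where
        nonnegative : ∀ n → f (+ n) ∼ g (+ n)
        nonnegative n = ≡.subst (λ z → f z ∼ g z) (progression-0-1 n) (agree-forward g-cubical agree n)
        downward : AgreeOn g (+ k) -[1+ 0 ] (suc k)
        downward i (s≤s i≤k) =
          ≡.subst (λ z → f z ∼ g z) (≡.sym (progression-downward i≤k)) (nonnegative (k ℕ.∸ i))

      polynomial-lift : Σ (ℤ → Carrier) λ g → IsPoly G Gᵢ g × (∀ m → f m ∼ g m)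
      polynomial-lift = finish (initial k)
        where
        finish : PartialLift (suc k) → Σ (ℤ → Carrier) λ g → IsPoly G Gᵢ g × (∀ m → f m ∼ g m)
        finish (g , g-cubical , agree) = g , Cubical⇒IsPoly g-cubical , agree-everywhere g-cubical agree

proposition6p3 : ∀ {c ℓ p q : Level} (G : Group c ℓ) (k : ℕ)
    (Gᵢ : ℕ → Group.Carrier G → Set p) → IsFiltration G k Gᵢ
    → (Γ : Group.Carrier G → Set q) → IsSubgroup G Γ
    → (N : ℕ) .{{_ : NonZero N}}
    → (φ : Fin N → Group.Carrier G) → IsMorphism G Γ Gᵢ N φ
    → (β : ℤ → Fin N) → IsHomℤ N β
    → Σ (ℤ → Group.Carrier G) (λ g → IsPoly G Gᵢ g × (∀ m → _≈Γ_ G Γ (φ (β m)) (g m)))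
proposition6p3 G k Gᵢ filtration Γ Γ-subgroup N φ φ-morphism β β-hom =
  polynomial-lift
  where
  open FilteredGroup G k Gᵢ filtration
  open Modulo Γ-subgroup
  open Lifting (λ m → φ (β m)) (morphism∘hom-cubical {Gᵢ = Gᵢ} {Γ} N {φ} {β} φ-morphism β-hom)
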